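{- There exists a deterministic procedure which, given access to the independent set oracle of a simple undirected graph $G=(V,E)$ with $n=|V|$ vertices and given a set $A\subseteq V$, outputs a list of all edges of the subgraph of $G$ induced on $A$, one at a time, such that for every $1\le t\le |E_A|$ the $t$-th edge is added to the list after at most $O(1+t\log n)$ independent set queries, and the procedure terminates after at most $O(1+|E_A|\log n)$ independent set queries in total, where $E_A$ denotes the set of edges with both endpoints in $A$.
   Context: Independent set oracle: given $U\subseteq V$, it returns $1$ if no edge of $G$ has both endpoints in $U$, and $0$ otherwise. The constants in $O(\cdot)$ are absolute. -}

module Defs where

open import Data.Nat using (ℕ; zero; suc; _+_; _*_; _≤_; _<ᵇ_)
open import Data.Bool using (Bool; true; false; _∧_; not; if_then_else_)
open import Data.Fin using (Fin; toℕ)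
open import Data.Fin.Subset using (Subset; _∈_)
open import Data.Vec using (lookup)
open import Data.List using (List; []; _∷_; map; concatMap; allFin)
open import Data.Bool.ListAction using (any)
open import Data.Nat.ListAction using (sum)
open import Data.List.Relation.Unary.All using (All)
open import Data.List.Relation.Unary.Any using (Any)
open import Data.List.Relation.Unary.AllPairs using (AllPairs)
open import Data.Product using (_×_; _,_)
open import Data.Sum using (_⊎_)
open import Relation.Binary.PropositionalEquality using (_≡_)
open import Relation.Nullary using (¬_)

record Graph (n : ℕ) : Set where
  field
    adj    : Fin n → Fin n → Bool
    sym    : ∀ u v → adj u v ≡ adj v u
    irrefl : ∀ u → adj u u ≡ false
open Graph public

pairs : (n : ℕ) → List (Fin n × Fin n)
pairs n = concatMap (λ u → map (λ v → (u , v)) (allFin n)) (allFin n)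

indepOracle : ∀ {n} → Graph n → Subset n → Bool
indepOracle {n} G U =
  not (any (λ { (u , v) → lookup U u ∧ lookup U v ∧ adj G u v }) (pairs n))

-- |E_A| : number of edges {u,v} (counted once, via toℕ u < toℕ v)
-- with both endpoints in A.
numEdges : ∀ {n} → Graph n → Subset n → ℕ
numEdges {n} G A =
  sum (map (λ { (u , v) → if (toℕ u <ᵇ toℕ v) ∧ lookup A u ∧ lookup A v ∧ adj G u v
                          then 1 else 0 }) (pairs n))

-- Deterministic oracle procedures (decision trees): query a subset and
-- continue depending on the answer, output an edge (pair of vertices), or stop.
data Proc (n : ℕ) : Set where
  query  : Subset n → (Bool → Proc n) → Proc n
  output : Fin n × Fin n → Proc n → Proc n
  done   : Proc n

data Event (n : ℕ) : Set where
  q   : Event n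
  out : Fin n × Fin n → Event n

run : ∀ {n} → Proc n → (Subset n → Bool) → List (Event n)
run (query U k) O = q ∷ run (k (O U)) O
run (output e p) O = out e ∷ run p O
run done O = []

outputs : ∀ {n} → List (Event n) → List (Fin n × Fin n)
outputs [] = []
outputs (q ∷ es) = outputs es
outputs (out e ∷ es) = e ∷ outputs es

totalQueries : ∀ {n} → List (Event n) → ℕ
totalQueries [] = 0
totalQueries (q ∷ es) = suc (totalQueries es)
totalQueries (out e ∷ es) = totalQueries es

-- queriesBefore tr t : number of queries made before the t-th output (t ≥ 1).
queriesBefore : ∀ {n} → List (Event n) → ℕ → ℕ
queriesBefore [] t = 0
queriesBefore (q ∷ es) t = suc (queriesBefore es t)
queriesBefore (out e ∷ es) zero = 0
queriesBefore (out e ∷ es) (suc zero) = 0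
queriesBefore (out e ∷ es) (suc (suc t)) = queriesBefore es (suc t)

EdgeIn : ∀ {n} → Graph n → Subset n → Fin n × Fin n → Set
EdgeIn G A (u , v) = u ∈ A × v ∈ A × adj G u v ≡ true

SameEdge : ∀ {n} → Fin n × Fin n → Fin n × Fin n → Set
SameEdge (u , v) (u' , v') = (u ≡ u' × v ≡ v') ⊎ (u ≡ v' × v ≡ u')

ListsEdges : ∀ {n} → Graph n → Subset n → List (Fin n × Fin n) → Set
ListsEdges {n} G A L =
  All (EdgeIn G A) L
  × (∀ (u v : Fin n) → u ∈ A → v ∈ A → adj G u v ≡ true → Any (SameEdge (u , v)) L)
  × AllPairs (λ e f → ¬ SameEdge e f) L

-- The algorithm works in rounds on a vertex set S, starting from A. A round scans S by dyadic
-- blocks of vertex indices while growing an independent set I: a block joins I when the oracle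
-- accepts I ∪ block, and is halved otherwise. A single vertex w that is rejected has a neighbour
-- in the current set J, and a binary search over dyadic blocks immediately outputs all of them;
-- after the scan, a second search outputs the neighbours of w in I ∖ J. Every edge of S meeting I
-- is thus listed exactly once, oriented from S ∖ I into I, and the next round handles S ∖ I.
--
-- A search finding m ≥ 1 neighbours makes at most 1 + 2 m ⌈log₂ n⌉ queries, and every rejected
-- vertex yields an output. So if each query costs one credit and each output earns 8 ⌈log₂ n⌉,
-- a run started with O(log n) credits never overdraws, which bounds the number of queries before
-- the t-th output by O(1 + t log n) and the total by O(1 + |E_A| log n).

module Submission where

open import Defs hiding (sym)
open import Data.Nat using (ℕ; zero; suc; _+_; _*_; _^_; _≤_; _<_; _≤ᵇ_; _<ᵇ_; _<?_; z≤n; s≤s; s≤s⁻¹; ⌈_/2⌉)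
open import Data.Nat.Properties hiding (_≟_)
open import Data.Nat.Tactic.RingSolver using (solve-∀)
open import Data.Nat.Induction using (<-wellFounded)
open import Data.Nat.Logarithm using (⌈log₂_⌉)
open import Data.Nat.Logarithm.Core using (⌈log2⌉)
open import Data.Nat.ListAction using (sum)
import Data.Nat.ListAction.Properties as ListAction
open import Induction.WellFounded using (Acc; acc)
open import Data.Bool using (Bool; true; false; _∧_; _∨_; not; T; if_then_else_)
open import Data.Bool.Properties using (T-≡; not-involutive)
open import Data.Fin using (Fin; zero; toℕ; fromℕ<; _≟_)
open import Data.Fin.Properties using (toℕ<n; toℕ-fromℕ<; toℕ-injective)
open import Data.Fin.Subset using (Subset)
import Data.Fin.Subset as Subset
open import Data.Fin.Subset.Properties using (p⊂q⇒∣p∣<∣q∣; ∣p∣≤n)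
open import Data.Vec using (lookup; tabulate)
open import Data.Vec.Properties using (lookup∘tabulate; lookup⇒[]=; []=⇒lookup)
open import Data.List using (List; []; _∷_; _++_; map; length; allFin)
open import Data.List.Properties using (map-++; length-++; length-map; ++-assoc; ++-identityʳ)
open import Data.List.Membership.Propositional using (_∈_)
open import Data.List.Membership.Propositional.Properties
  using (∈-allFin; ∈-concatMap⁺; ∈-map⁺; ∈-map⁻; ∈-++⁺ˡ; ∈-++⁺ʳ; ∈-++⁻; ∈-∃++)
open import Data.List.Relation.Unary.Any as Any using (Any; here; there)
import Data.List.Relation.Unary.Any.Properties as Any
open import Data.List.Relation.Unary.Any.Properties using (any⁺; any⁻; ¬Any[])
open import Data.List.Relation.Unary.All as All using (All; []; _∷_)
import Data.List.Relation.Unary.All.Properties as All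
open import Data.List.Relation.Unary.AllPairs as AllPairs using (AllPairs; []; _∷_)
import Data.List.Relation.Unary.AllPairs.Properties as AllPairs
open import Data.List.Relation.Unary.Unique.Propositional using (Unique)
import Data.List.Relation.Unary.Unique.Propositional.Properties as Unique
open import Data.Product using (_×_; _,_; proj₁; proj₂; ∃-syntax; Σ-syntax)
open import Data.Sum using (_⊎_; inj₁; inj₂; [_,_]; map₂)
open import Data.Empty using (⊥; ⊥-elim)
open import Data.Unit using (⊤; tt)
open import Function using (Equivalence; _∘_; id)
open import Relation.Nullary using (¬_; Dec; yes; no)
open import Relation.Nullary.Decidable using (⌊_⌋)
open import Relation.Binary.PropositionalEquality hiding ([_])

∧-true⁻ : ∀ {a b} → a ∧ b ≡ true → a ≡ true × b ≡ true
∧-true⁻ {true} {true} _ = refl , refl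

∧-true⁺ : ∀ {a b} → a ≡ true → b ≡ true → a ∧ b ≡ true
∧-true⁺ refl refl = refl

∨-true⁻ : ∀ {a b} → a ∨ b ≡ true → a ≡ true ⊎ b ≡ true
∨-true⁻ {true}  _ = inj₁ refl
∨-true⁻ {false} b = inj₂ b

∨-trueˡ : ∀ {a b} → a ≡ true → a ∨ b ≡ true
∨-trueˡ refl = refl

∨-trueʳ : ∀ a {b} → b ≡ true → a ∨ b ≡ true
∨-trueʳ true  _ = refl
∨-trueʳ false b = b

not-true⁻ : ∀ {a} → not a ≡ true → a ≡ false
not-true⁻ {false} _ = refl

not-true⁺ : ∀ {a} → a ≡ false → not a ≡ true
not-true⁺ refl = refl

true≢false : ∀ {a} → a ≡ true → a ≡ false → ⊥
true≢false refl ()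

T⇒≡true : ∀ {a} → T a → a ≡ true
T⇒≡true = Equivalence.to T-≡

≡true⇒T : ∀ {a} → a ≡ true → T a
≡true⇒T = Equivalence.from T-≡

∈⇒0<length : ∀ {A : Set} {x : A} {xs} → x ∈ xs → 0 < length xs
∈⇒0<length (here _)  = s≤s z≤n
∈⇒0<length (there _) = s≤s z≤n

Unique-keys⇒≡ : ∀ {A B : Set} {W : List (A × B)} {a b b′} →
                Unique (map proj₁ W) → (a , b) ∈ W → (a , b′) ∈ W → b ≡ b′
Unique-keys⇒≡ (_ ∷ _)   (here refl) (here refl) = refl
Unique-keys⇒≡ (a∉ ∷ _)  (here refl) (there p∈)  = ⊥-elim (All.lookup a∉ (∈-map⁺ proj₁ p∈) refl)
Unique-keys⇒≡ (a∉ ∷ _)  (there p∈)  (here refl) = ⊥-elim (All.lookup a∉ (∈-map⁺ proj₁ p∈) refl)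
Unique-keys⇒≡ (_ ∷ uniq) (there p∈) (there p∈′) = Unique-keys⇒≡ uniq p∈ p∈′

n≤2^⌈log2⌉n : ∀ n (rec : Acc _<_ n) → n ≤ 2 ^ ⌈log2⌉ n rec
n≤2^⌈log2⌉n zero          _         = z≤n
n≤2^⌈log2⌉n (suc zero)    _         = s≤s z≤n
n≤2^⌈log2⌉n (suc (suc m)) (acc _)   = ≤-trans m+2≤2[1+⌈m/2⌉] (*-monoʳ-≤ 2 (n≤2^⌈log2⌉n (suc ⌈ m /2⌉) _))
  where
  m≤⌈m/2⌉+⌈m/2⌉ : m ≤ ⌈ m /2⌉ + ⌈ m /2⌉
  m≤⌈m/2⌉+⌈m/2⌉ =
    ≤-trans (≤-reflexive (sym (⌊n/2⌋+⌈n/2⌉≡n m))) (+-monoˡ-≤ ⌈ m /2⌉ (⌊n/2⌋≤⌈n/2⌉ m))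
  m+2≤2[1+⌈m/2⌉] : suc (suc m) ≤ 2 * suc ⌈ m /2⌉
  m+2≤2[1+⌈m/2⌉] = ≤-trans (s≤s (s≤s m≤⌈m/2⌉+⌈m/2⌉)) (≤-reflexive (double ⌈ m /2⌉))
    where
    double : ∀ k → suc (suc (k + k)) ≡ 2 * suc k
    double = solve-∀

n≤2^⌈log₂n⌉ : ∀ n → n ≤ 2 ^ ⌈log₂ n ⌉
n≤2^⌈log₂n⌉ n = n≤2^⌈log2⌉n n (<-wellFounded n)

length≤sum : ∀ {X : Set} (f : X → ℕ) (P : List X) {xs} → Unique xs → (∀ {x} → x ∈ xs → x ∈ P) →
             (∀ {x} → x ∈ xs → f x ≡ 1) → length xs ≤ sum (map f P)
length≤sum f P {[]}     _          _   _  = z≤n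
length≤sum f P {x ∷ xs} (x∉ ∷ uniq) ⊆P f≡1 with ys , zs , refl ← ∈-∃++ (⊆P (here refl)) =
  ≤-trans (s≤s (length≤sum f (ys ++ zs) uniq ⊆ys++zs (f≡1 ∘ there))) (≤-reflexive (sym sum-split))
  where
  open ≡-Reasoning
  ⊆ys++zs : ∀ {y} → y ∈ xs → y ∈ ys ++ zs
  ⊆ys++zs y∈ with ∈-++⁻ ys (⊆P (there y∈))
  ... | inj₁ y∈ys          = ∈-++⁺ˡ y∈ys
  ... | inj₂ (here refl)   = ⊥-elim (All.lookup x∉ y∈ refl)
  ... | inj₂ (there y∈zs)  = ∈-++⁺ʳ ys y∈zs
  sum-split : sum (map f (ys ++ x ∷ zs)) ≡ suc (sum (map f (ys ++ zs)))
  sum-split = begin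
    sum (map f (ys ++ x ∷ zs))             ≡⟨ cong sum (map-++ f ys (x ∷ zs)) ⟩
    sum (map f ys ++ f x ∷ map f zs)       ≡⟨ ListAction.sum-++ (map f ys) (f x ∷ map f zs) ⟩
    sum (map f ys) + (f x + sum (map f zs)) ≡⟨ cong (λ k → sum (map f ys) + (k + sum (map f zs))) (f≡1 (here refl)) ⟩
    sum (map f ys) + suc (sum (map f zs))  ≡⟨ +-suc (sum (map f ys)) (sum (map f zs)) ⟩
    suc (sum (map f ys) + sum (map f zs))  ≡⟨ cong suc (sym (ListAction.sum-++ (map f ys) (map f zs))) ⟩
    suc (sum (map f ys ++ map f zs))       ≡⟨ cong (suc ∘ sum) (sym (map-++ f ys zs)) ⟩
    suc (sum (map f (ys ++ zs)))           ∎

VertexSet : ℕ → Set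
VertexSet n = Fin n → Bool

module _ {n : ℕ} where

  ∅ : VertexSet n
  ∅ _ = false

  ｛_｝ : Fin n → VertexSet n
  ｛ w ｝ x = ⌊ x ≟ w ⌋

  infixr 6 _∪_
  infixr 7 _∩_ _∖_

  _∪_ _∩_ _∖_ : VertexSet n → VertexSet n → VertexSet n
  (U ∪ V) x = U x ∨ V x
  (U ∩ V) x = U x ∧ V x
  (U ∖ V) x = U x ∧ not (V x)

  infix 4 _⊆_
  _⊆_ : VertexSet n → VertexSet n → Set
  U ⊆ V = ∀ x → U x ≡ true → V x ≡ true

  ∩-⊆ˡ : ∀ {U V} → U ∩ V ⊆ U
  ∩-⊆ˡ _ = proj₁ ∘ ∧-true⁻

  ∩-⊆ʳ : ∀ {U V} → U ∩ V ⊆ V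
  ∩-⊆ʳ _ = proj₂ ∘ ∧-true⁻

  ∖-⊆ : ∀ {U V} → U ∖ V ⊆ U
  ∖-⊆ _ = proj₁ ∘ ∧-true⁻

  ∈｛｝⁻ : ∀ {w x} → ｛ w ｝ x ≡ true → x ≡ w
  ∈｛｝⁻ {w} {x} x∈w with x ≟ w
  ... | yes x≡w = x≡w

  ∈｛｝⁺ : ∀ w → ｛ w ｝ w ≡ true
  ∈｛｝⁺ w with w ≟ w
  ... | yes _  = refl
  ... | no w≢w = ⊥-elim (w≢w refl)

  pair∈pairs : ∀ (u v : Fin n) → (u , v) ∈ pairs n
  pair∈pairs u v = ∈-concatMap⁺ (λ u → map (u ,_) (allFin n))
                     (Any.map (λ { refl → ∈-map⁺ (u ,_) (∈-allFin v) }) (∈-allFin u))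

module _ {n : ℕ} (G : Graph n) where

  Independent : VertexSet n → Set
  Independent U = ∀ u v → U u ≡ true → U v ≡ true → adj G u v ≡ false

  HasEdge : VertexSet n → Set
  HasEdge U = ∃[ u ] ∃[ v ] (U u ≡ true × U v ≡ true × adj G u v ≡ true)

  hasEdge⇒oracle-false : ∀ {U} → HasEdge U → indepOracle G (tabulate U) ≡ false
  hasEdge⇒oracle-false {U} (u , v , Uu , Uv , uv) =
    cong not (T⇒≡true (any⁺ _ (Any.map (λ { refl → edge }) (pair∈pairs u v))))
    where
    edge : T (lookup (tabulate U) u ∧ lookup (tabulate U) v ∧ adj G u v)
    edge rewrite lookup∘tabulate U u | lookup∘tabulate U v | Uu | Uv | uv = tt

  oracle-true⇒independent : ∀ {U} → indepOracle G (tabulate U) ≡ true → Independent U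
  oracle-true⇒independent {U} accepted u v Uu Uv with adj G u v in uv
  ... | false = refl
  ... | true  = ⊥-elim (true≢false accepted (hasEdge⇒oracle-false (u , v , Uu , Uv , uv)))

  oracle-false⇒hasEdge : ∀ {U} → indepOracle G (tabulate U) ≡ false → HasEdge U
  oracle-false⇒hasEdge {U} rejected
    with (u , v) , edge ← Any.satisfied (any⁻ _ (pairs n) (≡true⇒T (trans (sym (not-involutive _)) (cong not rejected))))
    with true ← lookup (tabulate U) u in Uu | true ← lookup (tabulate U) v in Uv | true ← adj G u v in uv
    = u , v , trans (sym (lookup∘tabulate U u)) Uu , trans (sym (lookup∘tabulate U v)) Uv , uv

  Independent-⊆ : ∀ {U V} → V ⊆ U → Independent U → Independent V
  Independent-⊆ V⊆U indU u v Vu Vv = indU u v (V⊆U u Vu) (V⊆U v Vv)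

  independent⇒neighbour∉ : ∀ {U x w} → Independent U → U x ≡ true → adj G x w ≡ true → U w ≡ false
  independent⇒neighbour∉ {U} {x} {w} indU Ux xw with U w in Uw
  ... | false = refl
  ... | true  = ⊥-elim (true≢false xw (indU x w Ux Uw))

  ｛｝-independent : ∀ w → Independent ｛ w ｝
  ｛｝-independent w u v u≡w v≡w rewrite ∈｛｝⁻ u≡w | ∈｛｝⁻ v≡w = irrefl G w

  crossing-edge : ∀ {U V} → Independent U → Independent V → HasEdge (U ∪ V) →
                  ∃[ u ] ∃[ v ] (U u ≡ true × V v ≡ true × adj G u v ≡ true)
  crossing-edge {U} indU indV (u , v , UVu , UVv , uv) with ∨-true⁻ {U u} UVu | ∨-true⁻ {U v} UVv
  ... | inj₁ Uu | inj₁ Uv = ⊥-elim (true≢false uv (indU u v Uu Uv))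
  ... | inj₁ Uu | inj₂ Vv = u , v , Uu , Vv , uv
  ... | inj₂ Vu | inj₁ Uv = v , u , Uv , Vu , trans (Graph.sym G v u) uv
  ... | inj₂ Vu | inj₂ Vv = ⊥-elim (true≢false uv (indV u v Vu Vv))

module _ {n : ℕ} where

  opaque
    block : ℕ → ℕ → VertexSet n
    block d a x = (a ≤ᵇ toℕ x) ∧ (toℕ x <ᵇ a + 2 ^ d)

    block⁻ : ∀ {d a x} → block d a x ≡ true → a ≤ toℕ x × toℕ x < a + 2 ^ d
    block⁻ {d} {a} {x} x∈ with a≤x , x<a+2ᵈ ← ∧-true⁻ x∈ =
      ≤ᵇ⇒≤ a (toℕ x) (≡true⇒T a≤x) , <ᵇ⇒< (toℕ x) (a + 2 ^ d) (≡true⇒T x<a+2ᵈ)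

    block⁺ : ∀ {d a x} → a ≤ toℕ x → toℕ x < a + 2 ^ d → block d a x ≡ true
    block⁺ a≤x x<a+2ᵈ = ∧-true⁺ (T⇒≡true (≤⇒≤ᵇ a≤x)) (T⇒≡true (<⇒<ᵇ x<a+2ᵈ))

  private
    end-suc : ∀ a d → a + 2 ^ suc d ≡ a + 2 ^ d + 2 ^ d
    end-suc a d = trans (cong (λ k → a + (2 ^ d + k)) (+-identityʳ (2 ^ d))) (sym (+-assoc a (2 ^ d) (2 ^ d)))

  block-split : ∀ {d a x} → block (suc d) a x ≡ true → block d a x ≡ true ⊎ block d (a + 2 ^ d) x ≡ true
  block-split {d} {a} {x} x∈ with a≤x , x<end ← block⁻ x∈ | toℕ x <? a + 2 ^ d
  ... | yes x<mid = inj₁ (block⁺ a≤x x<mid)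
  ... | no  x≮mid = inj₂ (block⁺ (≮⇒≥ x≮mid) (subst (toℕ x <_) (end-suc a d) x<end))

  block-left : ∀ {d a x} → block d a x ≡ true → block (suc d) a x ≡ true
  block-left {d} {a} x∈ with a≤x , x<mid ← block⁻ x∈ =
    block⁺ a≤x (<-≤-trans x<mid (≤-trans (m≤m+n (a + 2 ^ d) (2 ^ d)) (≤-reflexive (sym (end-suc a d)))))

  block-right : ∀ {d a x} → block d (a + 2 ^ d) x ≡ true → block (suc d) a x ≡ true
  block-right {d} {a} {x} x∈ with mid≤x , x<end ← block⁻ x∈ =
    block⁺ (≤-trans (m≤m+n a (2 ^ d)) mid≤x) (subst (toℕ x <_) (sym (end-suc a d)) x<end)

  block-disjoint : ∀ {d a x} → block d a x ≡ true → block d (a + 2 ^ d) x ≡ true → ⊥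
  block-disjoint x∈ˡ x∈ʳ = <⇒≱ (proj₂ (block⁻ x∈ˡ)) (proj₁ (block⁻ x∈ʳ))

  block-0⁻ : ∀ {a x} → block 0 a x ≡ true → toℕ x ≡ a
  block-0⁻ {a} {x} x∈ with a≤x , x<a+1 ← block⁻ x∈ =
    ≤-antisym (m<1+n⇒m≤n (subst (toℕ x <_) (+-comm a 1) x<a+1)) a≤x

  block-0⁺ : ∀ {a x} → toℕ x ≡ a → block 0 a x ≡ true
  block-0⁺ {a} refl = block⁺ ≤-refl (subst (a <_) (+-comm 1 a) ≤-refl)

  block-whole : ∀ {D} x → n ≤ 2 ^ D → block D 0 x ≡ true
  block-whole x n≤2ᴰ = block⁺ z≤n (<-≤-trans (toℕ<n x) n≤2ᴰ)

block-0-independent : ∀ {n} (G : Graph n) a → Independent G (block 0 a)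
block-0-independent G a u v u∈ v∈ =
  subst (λ v → adj G u v ≡ false) (toℕ-injective (trans (block-0⁻ u∈) (sym (block-0⁻ v∈)))) (irrefl G u)

data Prog (n : ℕ) (A : Set) : Set where
  return : A → Prog n A
  ask    : VertexSet n → (Bool → Prog n A) → Prog n A
  emit   : Fin n × Fin n → Prog n A → Prog n A

infixl 1 _>>=_ _>>_

_>>=_ : ∀ {n A B} → Prog n A → (A → Prog n B) → Prog n B
return x >>= f = f x
ask U k  >>= f = ask U (λ b → k b >>= f)
emit e p >>= f = emit e (p >>= f)

_>>_ : ∀ {n B} → Prog n ⊤ → Prog n B → Prog n B
p >> p′ = p >>= λ _ → p′

toProc : ∀ {n} → Prog n ⊤ → Proc n
toProc (return _) = done
toProc (ask U k)  = query (tabulate U) (λ b → toProc (k b))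
toProc (emit e p) = output e (toProc p)

module Execution {n : ℕ} (O : Subset n → Bool) where

  trace : ∀ {A} → Prog n A → List (Event n)
  trace (return _) = []
  trace (ask U k)  = q ∷ trace (k (O (tabulate U)))
  trace (emit e p) = out e ∷ trace p

  result : ∀ {A} → Prog n A → A
  result (return x) = x
  result (ask U k)  = result (k (O (tabulate U)))
  result (emit e p) = result p

  run-toProc : (p : Prog n ⊤) → run (toProc p) O ≡ trace p
  run-toProc (return _) = refl
  run-toProc (ask U k)  = cong (q ∷_) (run-toProc (k (O (tabulate U))))
  run-toProc (emit e p) = cong (out e ∷_) (run-toProc p)

  trace->>= : ∀ {A B} (p : Prog n A) (f : A → Prog n B) →
              trace (p >>= f) ≡ trace p ++ trace (f (result p))
  trace->>= (return x) f = refl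
  trace->>= (ask U k)  f = cong (q ∷_) (trace->>= (k (O (tabulate U))) f)
  trace->>= (emit e p) f = cong (out e ∷_) (trace->>= p f)

  result->>= : ∀ {A B} (p : Prog n A) (f : A → Prog n B) →
               result (p >>= f) ≡ result (f (result p))
  result->>= (return x) f = refl
  result->>= (ask U k)  f = result->>= (k (O (tabulate U))) f
  result->>= (emit e p) f = result->>= p f

outputs-++ : ∀ {n} (t t′ : List (Event n)) → outputs (t ++ t′) ≡ outputs t ++ outputs t′
outputs-++ []          t′ = refl
outputs-++ (q ∷ t)     t′ = outputs-++ t t′
outputs-++ (out e ∷ t) t′ = cong (e ∷_) (outputs-++ t t′)

-- Every query costs one credit and every output earns K; Pays b t c says that t, started
-- with b credits, never overdraws and ends with c.
module Credit {n : ℕ} (K : ℕ) where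

  data Pays : ℕ → List (Event n) → ℕ → Set where
    []       : ∀ {b} → Pays b [] b
    query∷_  : ∀ {b t c} → Pays b t c → Pays (suc b) (q ∷ t) c
    output∷_ : ∀ {b e t c} → Pays (b + K) t c → Pays b (out e ∷ t) c

  pays-++ : ∀ {b t c t′ d} → Pays b t c → Pays c t′ d → Pays b (t ++ t′) d
  pays-++ []           p′ = p′
  pays-++ (query∷ p)   p′ = query∷ pays-++ p p′
  pays-++ (output∷ p)  p′ = output∷ pays-++ p p′

  pays⇒queriesBefore : ∀ {b t c} → Pays b t c → ∀ i → queriesBefore t (suc i) ≤ b + i * K
  pays⇒queriesBefore []          i       = z≤n
  pays⇒queriesBefore (query∷ p)  i       = s≤s (pays⇒queriesBefore p i)
  pays⇒queriesBefore (output∷ p) zero    = z≤n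
  pays⇒queriesBefore {b} (output∷ p) (suc i) =
    ≤-trans (pays⇒queriesBefore p i) (≤-reflexive (+-assoc b K (i * K)))

  pays⇒totalQueries : ∀ {b t c} → Pays b t c →
                      totalQueries t + c ≡ b + length (outputs t) * K
  pays⇒totalQueries {b} []   = sym (+-identityʳ b)
  pays⇒totalQueries (query∷ p) = cong suc (pays⇒totalQueries p)
  pays⇒totalQueries {b} {out _ ∷ t} (output∷ p) =
    trans (pays⇒totalQueries p) (+-assoc b K (length (outputs t) * K))

  -- Earns δ m t: given more than δ credits, t ends at least m (K ∸ δ) ∸ 1 credits richer.
  Earns : ℕ → ℕ → List (Event n) → Set
  Earns δ m t = ∀ b → δ < b → ∃[ c ] (Pays b t c × b + m * K ≤ c + 1 + m * δ)

  Spends : ℕ → ℕ → List (Event n) → Set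
  Spends γ ℓ t = ∀ b → γ + ℓ ≤ b → ∃[ c ] (Pays b t c × b ≤ c + ℓ)

  private
    module _ {δ : ℕ} where
      open ≤-Reasoning

      surplus : ∀ {k m b c} → δ + k ≤ K → b + m * K ≤ c + 1 + m * δ → b + m * k ≤ c + 1
      surplus {k} {m} {b} {c} δ+k≤K earned = +-cancelʳ-≤ (m * δ) (b + m * k) (c + 1) (begin
        b + m * k + m * δ   ≡⟨ +-assoc b (m * k) (m * δ) ⟩
        b + (m * k + m * δ) ≡⟨ cong (b +_) (trans (sym (*-distribˡ-+ m k δ)) (cong (m *_) (+-comm k δ))) ⟩
        b + m * (δ + k)     ≤⟨ +-monoʳ-≤ b (*-monoʳ-≤ m δ+k≤K) ⟩
        b + m * K           ≤⟨ earned ⟩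
        c + 1 + m * δ       ∎)

      spent≤1 : ∀ {m b c} → δ ≤ K → b + m * K ≤ c + 1 + m * δ → b ≤ c + 1
      spent≤1 {m} {b} {c} δ≤K earned =
        +-cancelʳ-≤ (m * δ) b (c + 1) (≤-trans (+-monoʳ-≤ b (*-monoʳ-≤ m δ≤K)) earned)

      earnings-+ : ∀ {m₁ m₂ b c₁ c₂} →
                   b + m₁ * K ≤ c₁ + 1 + m₁ * δ → c₁ + m₂ * K ≤ c₂ + 1 + m₂ * δ →
                   b + (m₁ + m₂) * K ≤ c₂ + 2 + (m₁ + m₂) * δ
      earnings-+ {m₁} {m₂} {b} {c₁} {c₂} h₁ h₂ = +-cancelʳ-≤ c₁ _ _ (begin
        b + (m₁ + m₂) * K + c₁                   ≡⟨ regroupˡ b c₁ m₁ m₂ K ⟩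
        (b + m₁ * K) + (c₁ + m₂ * K)             ≤⟨ +-mono-≤ h₁ h₂ ⟩
        (c₁ + 1 + m₁ * δ) + (c₂ + 1 + m₂ * δ)    ≡⟨ regroupʳ c₁ c₂ m₁ m₂ δ ⟩
        c₂ + 2 + (m₁ + m₂) * δ + c₁              ∎)
        where
        regroupˡ : ∀ b c₁ m₁ m₂ K → b + (m₁ + m₂) * K + c₁ ≡ (b + m₁ * K) + (c₁ + m₂ * K)
        regroupˡ = solve-∀
        regroupʳ : ∀ c₁ c₂ m₁ m₂ δ →
                   (c₁ + 1 + m₁ * δ) + (c₂ + 1 + m₂ * δ) ≡ c₂ + 2 + (m₁ + m₂) * δ + c₁
        regroupʳ = solve-∀

      charge-node : ∀ {m b c} → 0 < m → b + m * K ≤ c + 2 + m * δ → suc b + m * K ≤ c + 1 + m * (2 + δ)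
      charge-node {suc m} {b} {c} _ h =
        ≤-trans (s≤s h) (≤-trans (m≤m+n _ (2 * m)) (≤-reflexive (expand c m δ)))
        where
        expand : ∀ c m δ → suc (c + 2 + suc m * δ) + 2 * m ≡ c + 1 + suc m * (2 + δ)
        expand = solve-∀

      charge-collapse : ∀ {m b c} → δ ≤ K → b + suc m * K ≤ c + 1 + suc m * δ →
                        suc b + 1 * K ≤ c + 1 + 1 * suc δ
      charge-collapse {m} {b} {c} δ≤K h = subst₂ _≤_ (lhs b K) (rhs c δ) (s≤s collapsed)
        where
        collapsed : b + K ≤ c + 1 + δ
        collapsed = +-cancelʳ-≤ (m * δ) _ _ (begin
          b + K + m * δ         ≤⟨ +-monoʳ-≤ (b + K) (*-monoʳ-≤ m δ≤K) ⟩
          b + K + m * K         ≡⟨ +-assoc b K (m * K) ⟩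
          b + suc m * K         ≤⟨ h ⟩
          c + 1 + suc m * δ     ≡⟨ sym (+-assoc (c + 1) δ (m * δ)) ⟩
          c + 1 + δ + m * δ     ∎)
        lhs : ∀ b K → suc (b + K) ≡ suc b + 1 * K
        lhs = solve-∀
        rhs : ∀ c δ → suc (c + 1 + δ) ≡ c + 1 + 1 * suc δ
        rhs = solve-∀

    threshold-after : ∀ {γ ℓ₁ ℓ₂ b c} → γ + (ℓ₁ + ℓ₂) ≤ b → b ≤ c + ℓ₁ → γ + ℓ₂ ≤ c
    threshold-after {γ} {ℓ₁} {ℓ₂} {b} {c} γ+ℓ≤b b≤c+ℓ₁ = +-cancelʳ-≤ ℓ₁ _ _ (begin
      γ + ℓ₂ + ℓ₁     ≡⟨ trans (+-assoc γ ℓ₂ ℓ₁) (cong (γ +_) (+-comm ℓ₂ ℓ₁)) ⟩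
      γ + (ℓ₁ + ℓ₂)   ≤⟨ γ+ℓ≤b ⟩
      b               ≤⟨ b≤c+ℓ₁ ⟩
      c + ℓ₁          ∎)
      where open ≤-Reasoning

    loss-+ : ∀ {ℓ₁ ℓ₂ b c₁ c₂} → b ≤ c₁ + ℓ₁ → c₁ ≤ c₂ + ℓ₂ → b ≤ c₂ + (ℓ₁ + ℓ₂)
    loss-+ {ℓ₁} {ℓ₂} {b} {c₁} {c₂} b≤c₁+ℓ₁ c₁≤c₂+ℓ₂ = begin
      b                 ≤⟨ b≤c₁+ℓ₁ ⟩
      c₁ + ℓ₁           ≤⟨ +-monoˡ-≤ ℓ₁ c₁≤c₂+ℓ₂ ⟩
      c₂ + ℓ₂ + ℓ₁      ≡⟨ trans (+-assoc c₂ ℓ₂ ℓ₁) (cong (c₂ +_) (+-comm ℓ₂ ℓ₁)) ⟩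
      c₂ + (ℓ₁ + ℓ₂)    ∎
      where open ≤-Reasoning

    surplus-depth : ∀ {γ m b c} → 0 < b → 0 < m → b + m * suc γ ≤ c + 1 → γ + m ≤ c
    surplus-depth {γ} {suc m} {b} {c} 0<b _ h = +-cancelʳ-≤ 1 _ _ (begin
      γ + suc m + 1                 ≤⟨ +-monoʳ-≤ (γ + suc m) 0<b ⟩
      γ + suc m + b                 ≤⟨ +-monoˡ-≤ b (m≤m+n (γ + suc m) (m * γ)) ⟩
      γ + suc m + m * γ + b         ≡⟨ regroup b γ m ⟩
      b + suc m * suc γ             ≤⟨ h ⟩
      c + 1                         ∎)
      where
      open ≤-Reasoning
      regroup : ∀ b γ m → γ + suc m + m * γ + b ≡ b + suc m * suc γ
      regroup = solve-∀

    surplus-margin : ∀ {m b c} → 0 < m → b + m * 2 ≤ c + 1 → b + m ≤ c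
    surplus-margin {suc m} {b} {c} _ h = +-cancelʳ-≤ 1 _ _ (begin
      b + suc m + 1                 ≤⟨ m≤m+n _ m ⟩
      b + suc m + 1 + m             ≡⟨ regroup b m ⟩
      b + suc m * 2                 ≤⟨ h ⟩
      c + 1                         ∎)
      where
      open ≤-Reasoning
      regroup : ∀ b m → b + suc m + 1 + m ≡ b + suc m * 2
      regroup = solve-∀

  earns-query : ∀ δ → Earns δ 0 (q ∷ [])
  earns-query δ (suc b) _ = b , query∷ [] , ≤-reflexive (shuffle b K δ)
    where
    shuffle : ∀ b K δ → suc b + 0 * K ≡ b + 1 + 0 * δ
    shuffle = solve-∀

  earns-output : ∀ {e} → Earns 0 1 (q ∷ out e ∷ [])
  earns-output (suc b) _ = b + K , query∷ output∷ [] , ≤-reflexive (shuffle b K)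
    where
    shuffle : ∀ b K → suc b + 1 * K ≡ b + K + 1 + 1 * 0
    shuffle = solve-∀

  earns-node : ∀ {δ m₁ m₂ t₁ t₂} → δ ≤ K → Earns δ m₁ t₁ → Earns δ m₂ t₂ → 0 < m₁ + m₂ →
               Earns (2 + δ) (m₁ + m₂) (q ∷ t₁ ++ t₂)
  earns-node {δ} {m₁} {m₂} δ≤K e₁ e₂ m>0 (suc b) 2+δ<1+b
    with c₁ , p₁ , h₁ ← e₁ b (≤-trans (n≤1+n _) (s≤s⁻¹ 2+δ<1+b))
    with c₂ , p₂ , h₂ ← e₂ c₁ (s≤s⁻¹ (≤-trans (s≤s⁻¹ 2+δ<1+b)
                                       (≤-trans (spent≤1 {m = m₁} δ≤K h₁) (≤-reflexive (+-comm c₁ 1)))))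
    = c₂ , query∷ pays-++ p₁ p₂ , charge-node {δ} m>0 (earnings-+ {δ} {m₁} {m₂} h₁ h₂)

  earns-collapse : ∀ {δ m t} → δ ≤ K → Earns δ m t → 0 < m → Earns (suc δ) 1 (q ∷ t)
  earns-collapse {δ} {suc m} δ≤K e _ (suc b) 1+δ<1+b
    with c , p , h ← e b (s≤s⁻¹ 1+δ<1+b)
    = c , query∷ p , charge-collapse {δ} {m} {b} δ≤K h

  earns⇒spends : ∀ {δ m t} → δ ≤ K → Earns δ m t → Spends δ 1 t
  earns⇒spends {δ} {m} δ≤K e b δ+1≤b
    with c , p , h ← e b (subst (_≤ b) (+-comm δ 1) δ+1≤b)
    = c , p , spent≤1 {m = m} δ≤K h

  spends-[] : ∀ {γ ℓ} → Spends γ ℓ []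
  spends-[] {ℓ = ℓ} b _ = b , [] , m≤m+n b ℓ

  spends-++ : ∀ {γ ℓ₁ ℓ₂ t₁ t₂} →
              Spends γ ℓ₁ t₁ → Spends γ ℓ₂ t₂ → Spends γ (ℓ₁ + ℓ₂) (t₁ ++ t₂)
  spends-++ {γ} {ℓ₁} {ℓ₂} s₁ s₂ b γ+ℓ≤b
    with c₁ , p₁ , b≤c₁+ℓ₁ ← s₁ b (≤-trans (+-monoʳ-≤ γ (m≤m+n ℓ₁ ℓ₂)) γ+ℓ≤b)
    with c₂ , p₂ , c₁≤c₂+ℓ₂ ← s₂ c₁ (threshold-after {γ} {ℓ₁} {ℓ₂} γ+ℓ≤b b≤c₁+ℓ₁)
    = c₂ , pays-++ p₁ p₂ , loss-+ {ℓ₁} {ℓ₂} b≤c₁+ℓ₁ c₁≤c₂+ℓ₂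

  -- The surplus earned by t₁ must cover both the credit depth γ + m needed by t₂ and
  -- the loss of up to m credits during t₂.
  spends-round : ∀ {δ γ m t₁ t₂ t₃} → δ + 2 ≤ K → δ + suc γ ≤ K → 0 < m →
                 Earns δ m t₁ → Spends γ m t₂ → Spends δ 1 t₃ → Spends δ 1 (t₁ ++ t₂ ++ t₃)
  spends-round {δ} {γ} {m} δ+2≤K δ+1+γ≤K m>0 e₁ s₂ s₃ b δ+1≤b
    with c₁ , p₁ , h₁ ← e₁ b (subst (_≤ b) (+-comm δ 1) δ+1≤b)
    with c₂ , p₂ , h₂ ← s₂ c₁ (surplus-depth (≤-trans (s≤s z≤n) (≤-trans (m≤n+m 1 δ) δ+1≤b)) m>0
                                (surplus {m = m} δ+1+γ≤K h₁))
    with b≤c₂ ← +-cancelʳ-≤ m _ _ (≤-trans (surplus-margin m>0 (surplus {m = m} δ+2≤K h₁)) h₂)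
    with c₃ , p₃ , h₃ ← s₃ c₂ (≤-trans δ+1≤b b≤c₂)
    = c₃ , pays-++ p₁ (pays-++ p₂ p₃) , ≤-trans b≤c₂ h₃

-- Neighbour search

module _ {n : ℕ} where

  emitEdgeTo : Fin n → (a : ℕ) → Dec (a < n) → Prog n ⊤
  emitEdgeTo w a (yes a<n) = emit (w , fromℕ< a<n) (return tt)
  emitEdgeTo w a (no _)    = return tt

  neighbours : Fin n → VertexSet n → ℕ → ℕ → Prog n ⊤
  neighbours w X zero a =
    ask (｛ w ｝ ∪ X ∩ block 0 a) λ independent →
      if independent then return tt else emitEdgeTo w a (a <? n)
  neighbours w X (suc d) a =
    ask (｛ w ｝ ∪ X ∩ block (suc d) a) λ independent →
      if independent then return tt else (neighbours w X d a >> neighbours w X d (a + 2 ^ d))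

module NeighbourSearch {n : ℕ} (G : Graph n) (K : ℕ) where
  open Execution (indepOracle G)
  open Credit {n} K

  record ListsNeighbours (w : Fin n) (X : VertexSet n) (d a : ℕ) (t : List (Event n)) : Set where
    field
      found    : List (Fin n)
      outputs≡ : outputs t ≡ map (w ,_) found
      sound    : ∀ {x} → x ∈ found → X x ≡ true × block d a x ≡ true × adj G w x ≡ true
      complete : ∀ {x} → X x ≡ true → block d a x ≡ true → adj G w x ≡ true → x ∈ found
      unique   : Unique found
      cost     : d * 2 ≤ K → Earns (d * 2) (length found) t

  lists-nothing : ∀ {w X d a} → indepOracle G (tabulate (｛ w ｝ ∪ X ∩ block d a)) ≡ true →
                  ListsNeighbours w X d a (q ∷ [])
  lists-nothing {w} {X} {d} {a} accepted = record
    { found    = []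
    ; outputs≡ = refl
    ; sound    = λ ()
    ; complete = λ {x} Xx x∈ wx → ⊥-elim (true≢false wx
                   (oracle-true⇒independent G accepted w x
                      (∨-trueˡ (∈｛｝⁺ w)) (∨-trueʳ (｛ w ｝ x) (∧-true⁺ Xx x∈))))
    ; unique   = []
    ; cost     = λ _ → earns-query (d * 2)
    }

  neighbour-in-block : ∀ {w X d a} → Independent G X →
                       indepOracle G (tabulate (｛ w ｝ ∪ X ∩ block d a)) ≡ false →
                       ∃[ x ] (X x ≡ true × block d a x ≡ true × adj G w x ≡ true)
  neighbour-in-block {w} {X} indX rejected =
    towards-X (crossing-edge G (｛｝-independent G w) (Independent-⊆ G ∩-⊆ˡ indX) (oracle-false⇒hasEdge G rejected))
    where
    towards-X : ∀ {d a} → ∃[ v ] ∃[ x ] (｛ w ｝ v ≡ true × (X ∩ block d a) x ≡ true × adj G v x ≡ true) →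
                ∃[ x ] (X x ≡ true × block d a x ≡ true × adj G w x ≡ true)
    towards-X (v , x , v≡w , x∈ , vx) =
      x , proj₁ (∧-true⁻ x∈) , proj₂ (∧-true⁻ x∈) , subst (λ v → adj G v x ≡ true) (∈｛｝⁻ v≡w) vx

  lists-one : ∀ {w X a} (a<n : a < n) → X (fromℕ< a<n) ≡ true → adj G w (fromℕ< a<n) ≡ true →
              ListsNeighbours w X 0 a (q ∷ out (w , fromℕ< a<n) ∷ [])
  lists-one {w} {X} {a} a<n Xv wv = record
    { found    = v ∷ []
    ; outputs≡ = refl
    ; sound    = λ { (here refl) → Xv , block-0⁺ (toℕ-fromℕ< a<n) , wv }
    ; complete = λ _ x∈ _ → here (toℕ-injective (trans (block-0⁻ x∈) (sym (toℕ-fromℕ< a<n))))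
    ; unique   = [] ∷ []
    ; cost     = λ _ → earns-output
    }
    where v = fromℕ< a<n

  lists-node : ∀ {w X d a t₁ t₂} →
               ListsNeighbours w X d a t₁ → ListsNeighbours w X d (a + 2 ^ d) t₂ →
               (∃[ x ] (X x ≡ true × block (suc d) a x ≡ true × adj G w x ≡ true)) →
               ListsNeighbours w X (suc d) a (q ∷ t₁ ++ t₂)
  lists-node {w} {X} {d} {a} {t₁} {t₂} L₁ L₂ (x , Xx , x∈ , wx) = record
    { found    = L₁.found ++ L₂.found
    ; outputs≡ = trans (outputs-++ t₁ t₂)
                   (trans (cong₂ _++_ L₁.outputs≡ L₂.outputs≡) (sym (map-++ (w ,_) L₁.found L₂.found)))
    ; sound    = [ sound-left , sound-right ] ∘ ∈-++⁻ L₁.found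
    ; complete = complete
    ; unique   = Unique.++⁺ L₁.unique L₂.unique
                   (λ (y∈₁ , y∈₂) → block-disjoint (proj₁ (proj₂ (L₁.sound y∈₁)))
                                                   (proj₁ (proj₂ (L₂.sound y∈₂))))
    ; cost     = λ 2+2d≤K → let 2d≤K = ≤-trans (m≤n+m (d * 2) 2) 2+2d≤K in
                   subst (λ m → Earns (suc d * 2) m (q ∷ t₁ ++ t₂)) (sym (length-++ L₁.found))
                     (earns-node {m₁ = length L₁.found} {m₂ = length L₂.found} 2d≤K (L₁.cost 2d≤K) (L₂.cost 2d≤K) nonempty)
    }
    where
    module L₁ = ListsNeighbours L₁
    module L₂ = ListsNeighbours L₂
    sound-left : ∀ {y} → y ∈ L₁.found → X y ≡ true × block (suc d) a y ≡ true × adj G w y ≡ true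
    sound-left y∈ with Xy , y∈b , wy ← L₁.sound y∈ = Xy , block-left y∈b , wy
    sound-right : ∀ {y} → y ∈ L₂.found → X y ≡ true × block (suc d) a y ≡ true × adj G w y ≡ true
    sound-right y∈ with Xy , y∈b , wy ← L₂.sound y∈ = Xy , block-right y∈b , wy
    complete : ∀ {y} → X y ≡ true → block (suc d) a y ≡ true → adj G w y ≡ true → y ∈ L₁.found ++ L₂.found
    complete Xy y∈ wy with block-split y∈
    ... | inj₁ y∈₁ = ∈-++⁺ˡ (L₁.complete Xy y∈₁ wy)
    ... | inj₂ y∈₂ = ∈-++⁺ʳ L₁.found (L₂.complete Xy y∈₂ wy)
    nonempty : 0 < length L₁.found + length L₂.found
    nonempty = subst (0 <_) (length-++ L₁.found) (∈⇒0<length (complete Xx x∈ wx))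

  neighbours-lists : ∀ {w X} → Independent G X → ∀ d a → ListsNeighbours w X d a (trace (neighbours w X d a))
  neighbours-lists {w} {X} indX zero a = answered _ refl
    where
    leaf : ∃[ x ] (X x ≡ true × block 0 a x ≡ true × adj G w x ≡ true) → (a<?n : Dec (a < n)) →
           ListsNeighbours w X 0 a (q ∷ trace (emitEdgeTo w a a<?n))
    leaf (x , Xx , x∈ , wx) (yes a<n) with refl ← toℕ-injective (trans (block-0⁻ x∈) (sym (toℕ-fromℕ< a<n))) =
      lists-one a<n Xx wx
    leaf (x , _  , x∈ , _)  (no a≮n)  = ⊥-elim (a≮n (subst (_< n) (block-0⁻ x∈) (toℕ<n x)))
    answered : ∀ b → indepOracle G (tabulate (｛ w ｝ ∪ X ∩ block 0 a)) ≡ b →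
               ListsNeighbours w X 0 a (q ∷ trace (if b then return tt else emitEdgeTo w a (a <? n)))
    answered true  accepted = lists-nothing accepted
    answered false rejected = leaf (neighbour-in-block indX rejected) (a <? n)
  neighbours-lists {w} {X} indX (suc d) a = answered _ refl
    where
    left = neighbours w X d a
    right = neighbours w X d (a + 2 ^ d)
    answered : ∀ b → indepOracle G (tabulate (｛ w ｝ ∪ X ∩ block (suc d) a)) ≡ b →
               ListsNeighbours w X (suc d) a (q ∷ trace (if b then return tt else (left >> right)))
    answered true  accepted = lists-nothing accepted
    answered false rejected =
      subst (ListsNeighbours w X (suc d) a) (cong (q ∷_) (sym (trace->>= left _)))
        (lists-node (neighbours-lists indX d a) (neighbours-lists indX d (a + 2 ^ d)) (neighbour-in-block indX rejected))

-- Greedy scan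

-- Each rejected vertex is paired with the independent set that rejected it.
Rejections : ℕ → Set
Rejections n = List (Fin n × VertexSet n)

module _ {n : ℕ} where

  reject : VertexSet n → ℕ → (a : ℕ) → Dec (a < n) → Prog n (VertexSet n × Rejections n)
  reject J D a (yes a<n) = neighbours (fromℕ< a<n) J D 0 >> return (J , (fromℕ< a<n , J) ∷ [])
  reject J D a (no _)    = return (J , [])

  greedy : VertexSet n → VertexSet n → ℕ → ℕ → ℕ → Prog n (VertexSet n × Rejections n)
  greedy S J D zero a =
    ask (J ∪ S ∩ block 0 a) λ independent →
      if independent then return (J ∪ S ∩ block 0 a , []) else reject J D a (a <? n)
  greedy S J D (suc d) a =
    ask (J ∪ S ∩ block (suc d) a) λ independent →
      if independent then return (J ∪ S ∩ block (suc d) a , []) else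
        (greedy S J D d a >>= λ (J₁ , W₁) →
         greedy S J₁ D d (a + 2 ^ d) >>= λ (J₂ , W₂) →
         return (J₂ , W₁ ++ W₂))

module GreedyScan {n : ℕ} (G : Graph n) (K D : ℕ) (n≤2ᴰ : n ≤ 2 ^ D) where
  open Execution (indepOracle G)
  open Credit {n} K
  open NeighbourSearch G K

  Rejected : VertexSet n → ℕ → ℕ → VertexSet n → Fin n × VertexSet n → Set
  Rejected S d a I (w , Jw) =
    S w ≡ true × block d a w ≡ true × I w ≡ false × Jw ⊆ I × ∃[ x ] (Jw x ≡ true × adj G w x ≡ true)

  record Scans (S J : VertexSet n) (d a : ℕ) (t : List (Event n)) (I : VertexSet n) (W : Rejections n) : Set where
    field
      independent : Independent G I
      extends     : J ⊆ I
      within      : ∀ x → I x ≡ true → J x ≡ true ⊎ (S x ≡ true × block d a x ≡ true)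
      covered     : ∀ x → S x ≡ true → block d a x ≡ true → I x ≡ false → x ∈ map proj₁ W
      rejected    : All (Rejected S d a I) W
      distinct    : Unique (map proj₁ W)
      sound       : ∀ {w x} → (w , x) ∈ outputs t → ∃[ Jw ] ((w , Jw) ∈ W × Jw x ≡ true × adj G w x ≡ true)
      complete    : ∀ {w Jw x} → (w , Jw) ∈ W → Jw x ≡ true → adj G w x ≡ true → (w , x) ∈ outputs t
      unique      : Unique (outputs t)
      -- A rejected leaf costs one query plus a neighbour search of depth D; each level above adds two.
      cost        : d * 2 + suc (D * 2) ≤ K → Earns (d * 2 + suc (D * 2)) (length W) t

  rejected-in-block : ∀ {S d a I W w} → All (Rejected S d a I) W → w ∈ map proj₁ W → block d a w ≡ true
  rejected-in-block rej w∈ with (_ , Jw) , p∈ , refl ← ∈-map⁻ proj₁ w∈ = proj₁ (proj₂ (All.lookup rej p∈))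

  scan-accept : ∀ {S J d a} → indepOracle G (tabulate (J ∪ S ∩ block d a)) ≡ true →
                Scans S J d a (q ∷ []) (J ∪ S ∩ block d a) []
  scan-accept {S} {J} {d} accepted = record
    { independent = oracle-true⇒independent G accepted
    ; extends     = λ _ → ∨-trueˡ
    ; within      = λ x → map₂ ∧-true⁻ ∘ ∨-true⁻
    ; covered     = λ x Sx x∈ notI → ⊥-elim (true≢false (∨-trueʳ (J x) (∧-true⁺ Sx x∈)) notI)
    ; rejected    = []
    ; distinct    = []
    ; sound       = λ ()
    ; complete    = λ ()
    ; unique      = []
    ; cost        = λ _ → earns-query (d * 2 + suc (D * 2))
    }

  scan-reject : ∀ {S J a t} (a<n : a < n) → Independent G J →
                S (fromℕ< a<n) ≡ true → J (fromℕ< a<n) ≡ false →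
                (∃[ x ] (J x ≡ true × adj G (fromℕ< a<n) x ≡ true)) →
                ListsNeighbours (fromℕ< a<n) J D 0 t →
                Scans S J 0 a (q ∷ t) J ((fromℕ< a<n , J) ∷ [])
  scan-reject {S} {J} {a} {t} a<n indJ Sw Jw (x , Jx , wx) L = record
    { independent = indJ
    ; extends     = λ _ → id
    ; within      = λ _ → inj₁
    ; covered     = λ y _ y∈ _ → here (toℕ-injective (trans (block-0⁻ y∈) (sym (toℕ-fromℕ< a<n))))
    ; rejected    = (Sw , block-0⁺ (toℕ-fromℕ< a<n) , Jw , (λ _ → id) , x , Jx , wx) ∷ []
    ; distinct    = [] ∷ []
    ; sound       = sound
    ; complete    = λ { (here refl) Jy wy →
                        subst (_ ∈_) (sym L.outputs≡) (∈-map⁺ (w ,_) (L.complete Jy (block-whole _ n≤2ᴰ) wy)) }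
    ; unique      = subst Unique (sym L.outputs≡) (Unique.map⁺ (cong proj₂) L.unique)
    ; cost        = λ 1+2D≤K → let 2D≤K = ≤-trans (n≤1+n _) 1+2D≤K in
                      earns-collapse {m = length L.found} 2D≤K (L.cost 2D≤K) (∈⇒0<length (L.complete Jx (block-whole x n≤2ᴰ) wx))
    }
    where
    module L = ListsNeighbours L
    w = fromℕ< a<n
    sound : ∀ {v y} → (v , y) ∈ outputs t → ∃[ Jv ] ((v , Jv) ∈ (w , J) ∷ [] × Jv y ≡ true × adj G v y ≡ true)
    sound e∈ with y , y∈ , refl ← ∈-map⁻ (w ,_) (subst (_ ∈_) L.outputs≡ e∈)
      = J , here refl , proj₁ (L.sound y∈) , proj₂ (proj₂ (L.sound y∈))

  scan-node : ∀ {S J d a t₁ t₂ J₁ W₁ J₂ W₂} →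
              Scans S J d a t₁ J₁ W₁ → Scans S J₁ d (a + 2 ^ d) t₂ J₂ W₂ →
              HasEdge G (J ∪ S ∩ block (suc d) a) →
              Scans S J (suc d) a (q ∷ t₁ ++ t₂) J₂ (W₁ ++ W₂)
  scan-node {S} {J} {d} {a} {t₁} {t₂} {J₁} {W₁} {J₂} {W₂} R₁ R₂ (u , v , u∈ , v∈ , uv) = record
    { independent = R₂.independent
    ; extends     = λ x → R₂.extends x ∘ R₁.extends x
    ; within      = within
    ; covered     = covered
    ; rejected    = All.++⁺ (All.map rejected-left R₁.rejected) (All.map rejected-right R₂.rejected)
    ; distinct    = subst Unique (sym (map-++ proj₁ W₁ W₂))
                      (Unique.++⁺ R₁.distinct R₂.distinct
                        (λ (w∈₁ , w∈₂) → block-disjoint (rejected-in-block R₁.rejected w∈₁)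
                                                        (rejected-in-block R₂.rejected w∈₂)))
    ; sound       = sound
    ; complete    = complete
    ; unique      = subst Unique (sym (outputs-++ t₁ t₂))
                      (Unique.++⁺ R₁.unique R₂.unique (λ (e∈₁ , e∈₂) → outputs-disjoint e∈₁ e∈₂))
    ; cost        = λ δ≤K → subst (λ m → Earns (suc d * 2 + suc (D * 2)) m (q ∷ t₁ ++ t₂)) (sym (length-++ W₁))
                      (earns-node {m₁ = length W₁} {m₂ = length W₂} (child δ≤K) (R₁.cost (child δ≤K)) (R₂.cost (child δ≤K))
                        (subst (0 <_) (trans (length-map proj₁ (W₁ ++ W₂)) (length-++ W₁))
                           (∈⇒0<length (proj₂ some-rejected))))
    }
    where
    module R₁ = Scans R₁
    module R₂ = Scans R₂
    child : suc d * 2 + suc (D * 2) ≤ K → d * 2 + suc (D * 2) ≤ K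
    child = ≤-trans (m≤n+m _ 2)

    within : ∀ x → J₂ x ≡ true → J x ≡ true ⊎ (S x ≡ true × block (suc d) a x ≡ true)
    within x J₂x with R₂.within x J₂x
    ... | inj₂ (Sx , x∈) = inj₂ (Sx , block-right x∈)
    ... | inj₁ J₁x with R₁.within x J₁x
    ...   | inj₁ Jx        = inj₁ Jx
    ...   | inj₂ (Sx , x∈) = inj₂ (Sx , block-left x∈)

    covered : ∀ x → S x ≡ true → block (suc d) a x ≡ true → J₂ x ≡ false → x ∈ map proj₁ (W₁ ++ W₂)
    covered x Sx x∈ J₂x rewrite map-++ proj₁ W₁ W₂ with block-split x∈ | J₁ x in J₁x
    ... | inj₂ x∈₂ | _     = ∈-++⁺ʳ (map proj₁ W₁) (R₂.covered x Sx x∈₂ J₂x)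
    ... | inj₁ x∈₁ | false = ∈-++⁺ˡ (R₁.covered x Sx x∈₁ J₁x)
    ... | inj₁ _   | true  = ⊥-elim (true≢false (R₂.extends x J₁x) J₂x)

    rejected-left : ∀ {p} → Rejected S d a J₁ p → Rejected S (suc d) a J₂ p
    rejected-left {w , Jw} (Sw , w∈ , J₁w , Jw⊆J₁ , nb) =
      Sw , block-left w∈ , J₂w , (λ x → R₂.extends x ∘ Jw⊆J₁ x) , nb
      where
      J₂w : J₂ w ≡ false
      J₂w with J₂ w in J₂w≡
      ... | false = refl
      ... | true with R₂.within w J₂w≡
      ...   | inj₁ J₁w′       = ⊥-elim (true≢false J₁w′ J₁w)
      ...   | inj₂ (_ , w∈′) = ⊥-elim (block-disjoint w∈ w∈′)

    rejected-right : ∀ {p} → Rejected S d (a + 2 ^ d) J₂ p → Rejected S (suc d) a J₂ p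
    rejected-right (Sw , w∈ , rest) = Sw , block-right w∈ , rest

    sound : ∀ {w x} → (w , x) ∈ outputs (t₁ ++ t₂) →
            ∃[ Jw ] ((w , Jw) ∈ W₁ ++ W₂ × Jw x ≡ true × adj G w x ≡ true)
    sound e∈ with ∈-++⁻ (outputs t₁) (subst (_ ∈_) (outputs-++ t₁ t₂) e∈)
    ... | inj₁ e∈₁ with Jw , p∈ , rest ← R₁.sound e∈₁ = Jw , ∈-++⁺ˡ p∈ , rest
    ... | inj₂ e∈₂ with Jw , p∈ , rest ← R₂.sound e∈₂ = Jw , ∈-++⁺ʳ W₁ p∈ , rest

    complete : ∀ {w Jw x} → (w , Jw) ∈ W₁ ++ W₂ → Jw x ≡ true → adj G w x ≡ true →
               (w , x) ∈ outputs (t₁ ++ t₂)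
    complete p∈ Jx wx rewrite outputs-++ t₁ t₂ with ∈-++⁻ W₁ p∈
    ... | inj₁ p∈₁ = ∈-++⁺ˡ (R₁.complete p∈₁ Jx wx)
    ... | inj₂ p∈₂ = ∈-++⁺ʳ (outputs t₁) (R₂.complete p∈₂ Jx wx)

    outputs-disjoint : ∀ {e} → e ∈ outputs t₁ → e ∈ outputs t₂ → ⊥
    outputs-disjoint e∈₁ e∈₂ with _ , p∈₁ , _ ← R₁.sound e∈₁ | _ , p∈₂ , _ ← R₂.sound e∈₂ =
      block-disjoint (proj₁ (proj₂ (All.lookup R₁.rejected p∈₁))) (proj₁ (proj₂ (All.lookup R₂.rejected p∈₂)))

    outside : ∀ x → (J ∪ S ∩ block (suc d) a) x ≡ true → J₂ x ≡ false → x ∈ map proj₁ (W₁ ++ W₂)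
    outside x x∈ J₂x with ∨-true⁻ {J x} x∈
    ... | inj₁ Jx  = ⊥-elim (true≢false (R₂.extends x (R₁.extends x Jx)) J₂x)
    ... | inj₂ Sx∈ = covered x (proj₁ (∧-true⁻ Sx∈)) (proj₂ (∧-true⁻ Sx∈)) J₂x

    -- The edge found by the query cannot lie inside the independent set J₂.
    some-rejected : ∃[ x ] (x ∈ map proj₁ (W₁ ++ W₂))
    some-rejected with J₂ u in J₂u | J₂ v in J₂v
    ... | true  | true  = ⊥-elim (true≢false uv (R₂.independent u v J₂u J₂v))
    ... | false | _     = u , outside u u∈ J₂u
    ... | true  | false = v , outside v v∈ J₂v

  scans-cong : ∀ {S J d a t t′ r r′} → t ≡ t′ → r ≡ r′ →
               Scans S J d a t (proj₁ r) (proj₂ r) → Scans S J d a t′ (proj₁ r′) (proj₂ r′)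
  scans-cong refl refl R = R

  leaf-rejection : ∀ {S J a} → Independent G J → indepOracle G (tabulate (J ∪ S ∩ block 0 a)) ≡ false →
                   ∃[ w ] (S w ≡ true × block 0 a w ≡ true × J w ≡ false × ∃[ x ] (J x ≡ true × adj G w x ≡ true))
  leaf-rejection {S} {J} {a} indJ rejected =
    towards-S (crossing-edge G indJ (Independent-⊆ G ∩-⊆ʳ (block-0-independent G a)) (oracle-false⇒hasEdge G rejected))
    where
    towards-S : ∃[ x ] ∃[ w ] (J x ≡ true × (S ∩ block 0 a) w ≡ true × adj G x w ≡ true) →
                ∃[ w ] (S w ≡ true × block 0 a w ≡ true × J w ≡ false × ∃[ x ] (J x ≡ true × adj G w x ≡ true))
    towards-S (x , w , Jx , w∈ , xw) =
      w , proj₁ (∧-true⁻ w∈) , proj₂ (∧-true⁻ w∈) , independent⇒neighbour∉ G indJ Jx xw ,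
      x , Jx , trans (Graph.sym G w x) xw

  greedy-scans : ∀ {S J} → Independent G J → ∀ d a →
                 let r = result (greedy S J D d a) in Scans S J d a (trace (greedy S J D d a)) (proj₁ r) (proj₂ r)
  greedy-scans {S} {J} indJ zero a = answered _ refl
    where
    leaf : ∃[ w ] (S w ≡ true × block 0 a w ≡ true × J w ≡ false × ∃[ x ] (J x ≡ true × adj G w x ≡ true)) →
           (a<?n : Dec (a < n)) →
           let r = result (reject J D a a<?n) in Scans S J 0 a (q ∷ trace (reject J D a a<?n)) (proj₁ r) (proj₂ r)
    leaf (w , Sw , w∈ , Jw , nb) (yes a<n) with refl ← toℕ-injective (trans (block-0⁻ w∈) (sym (toℕ-fromℕ< a<n))) =
      scans-cong (cong (q ∷_) (sym (trans (trace->>= search _) (++-identityʳ _)))) (sym (result->>= search _))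
        (scan-reject a<n indJ Sw Jw nb (neighbours-lists indJ D 0))
      where search = neighbours (fromℕ< a<n) J D 0
    leaf (w , _ , w∈ , _) (no a≮n) = ⊥-elim (a≮n (subst (_< n) (block-0⁻ w∈) (toℕ<n w)))
    answered : ∀ b → indepOracle G (tabulate (J ∪ S ∩ block 0 a)) ≡ b →
               let p = if b then return (J ∪ S ∩ block 0 a , []) else reject J D a (a <? n)
               in Scans S J 0 a (q ∷ trace p) (proj₁ (result p)) (proj₂ (result p))
    answered true  accepted = scan-accept accepted
    answered false rejected = leaf (leaf-rejection indJ rejected) (a <? n)
  greedy-scans {S} {J} indJ (suc d) a = answered _ refl
    where
    left = greedy S J D d a
    R₁ = greedy-scans {S} indJ d a
    right = greedy S (proj₁ (result left)) D d (a + 2 ^ d)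
    both = left >>= λ (J₁ , W₁) → greedy S J₁ D d (a + 2 ^ d) >>= λ (J₂ , W₂) → return (J₂ , W₁ ++ W₂)
    answered : ∀ b → indepOracle G (tabulate (J ∪ S ∩ block (suc d) a)) ≡ b →
               let p = if b then return (J ∪ S ∩ block (suc d) a , []) else both
               in Scans S J (suc d) a (q ∷ trace p) (proj₁ (result p)) (proj₂ (result p))
    answered true  accepted = scan-accept accepted
    answered false rejected =
      scans-cong (cong (q ∷_) (sym (trans (trace->>= left _) (cong (trace left ++_) (trans (trace->>= right _) (++-identityʳ _))))))
                 (sym (trans (result->>= left _) (result->>= right _)))
        (scan-node R₁ (greedy-scans (Scans.independent R₁) d (a + 2 ^ d)) (oracle-false⇒hasEdge G rejected))

-- Rounds

module _ {n : ℕ} where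

  linkRejected : VertexSet n → ℕ → Rejections n → Prog n ⊤
  linkRejected I D []             = return tt
  linkRejected I D ((w , Jw) ∷ W) = neighbours w (I ∖ Jw) D 0 >> linkRejected I D W

module Linking {n : ℕ} (G : Graph n) (K D : ℕ) (n≤2ᴰ : n ≤ 2 ^ D) where
  open Execution (indepOracle G)
  open Credit {n} K
  open NeighbourSearch G K

  record Links (I : VertexSet n) (W : Rejections n) (t : List (Event n)) : Set where
    field
      sound    : ∀ {w x} → (w , x) ∈ outputs t →
                 ∃[ Jw ] ((w , Jw) ∈ W × I x ≡ true × Jw x ≡ false × adj G w x ≡ true)
      complete : ∀ {w Jw x} → (w , Jw) ∈ W → I x ≡ true → Jw x ≡ false → adj G w x ≡ true → (w , x) ∈ outputs t
      unique   : Unique (map proj₁ W) → Unique (outputs t)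
      cost     : D * 2 ≤ K → Spends (D * 2) (length W) t

  links-[] : ∀ {I} → Links I [] []
  links-[] = record
    { sound    = λ ()
    ; complete = λ ()
    ; unique   = λ _ → []
    ; cost     = λ _ → spends-[]
    }

  links-∷ : ∀ {I w Jw W t₁ t₂} → ListsNeighbours w (I ∖ Jw) D 0 t₁ → Links I W t₂ →
            Links I ((w , Jw) ∷ W) (t₁ ++ t₂)
  links-∷ {I} {w} {Jw} {W} {t₁} {t₂} L R = record
    { sound    = sound
    ; complete = complete
    ; unique   = unique
    ; cost     = λ 2D≤K → spends-++ {ℓ₁ = 1} {ℓ₂ = length W}
                              (earns⇒spends {m = length L.found} 2D≤K (L.cost 2D≤K)) (R.cost 2D≤K)
    }
    where
    module L = ListsNeighbours L
    module R = Links R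
    sound : ∀ {v x} → (v , x) ∈ outputs (t₁ ++ t₂) →
            ∃[ Jv ] ((v , Jv) ∈ (w , Jw) ∷ W × I x ≡ true × Jv x ≡ false × adj G v x ≡ true)
    sound e∈ with ∈-++⁻ (outputs t₁) (subst (_ ∈_) (outputs-++ t₁ t₂) e∈)
    ... | inj₂ e∈₂ with Jv , p∈ , rest ← R.sound e∈₂ = Jv , there p∈ , rest
    ... | inj₁ e∈₁ with x , x∈ , refl ← ∈-map⁻ (w ,_) (subst (_ ∈_) L.outputs≡ e∈₁)
                   with I∖Jx , _ , wx ← L.sound x∈
      = Jw , here refl , proj₁ (∧-true⁻ I∖Jx) , not-true⁻ (proj₂ (∧-true⁻ I∖Jx)) , wx
    complete : ∀ {v Jv x} → (v , Jv) ∈ (w , Jw) ∷ W → I x ≡ true → Jv x ≡ false → adj G v x ≡ true →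
               (v , x) ∈ outputs (t₁ ++ t₂)
    complete {x = x} (here refl) Ix Jx wx rewrite outputs-++ t₁ t₂ =
      ∈-++⁺ˡ (subst ((w , x) ∈_) (sym L.outputs≡)
        (∈-map⁺ (w ,_) (L.complete (∧-true⁺ Ix (not-true⁺ Jx)) (block-whole x n≤2ᴰ) wx)))
    complete (there p∈) Ix Jx vx rewrite outputs-++ t₁ t₂ = ∈-++⁺ʳ (outputs t₁) (R.complete p∈ Ix Jx vx)
    unique : Unique (map proj₁ ((w , Jw) ∷ W)) → Unique (outputs (t₁ ++ t₂))
    unique (w∉W ∷ distinct) rewrite outputs-++ t₁ t₂ =
      Unique.++⁺ (subst Unique (sym L.outputs≡) (Unique.map⁺ (cong proj₂) L.unique)) (R.unique distinct) disjoint
      where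
      disjoint : ∀ {e} → e ∈ outputs t₁ × e ∈ outputs t₂ → ⊥
      disjoint (e∈₁ , e∈₂) with _ , _ , refl ← ∈-map⁻ (w ,_) (subst (_ ∈_) L.outputs≡ e∈₁)
                           with _ , p∈ , _ ← R.sound e∈₂
        = All.lookup w∉W (∈-map⁺ proj₁ p∈) refl

  linkRejected-links : ∀ {I} → Independent G I → ∀ W → Links I W (trace (linkRejected I D W))
  linkRejected-links indI [] = links-[]
  linkRejected-links {I} indI ((w , Jw) ∷ W) =
    subst (Links I ((w , Jw) ∷ W)) (sym (trace->>= (neighbours w (I ∖ Jw) D 0) _))
      (links-∷ (neighbours-lists (Independent-⊆ G ∖-⊆ indI) D 0) (linkRejected-links indI W))

module _ {n : ℕ} where

  size : VertexSet n → ℕ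
  size U = Subset.∣ tabulate U ∣

  private
    ∈tabulate⁺ : ∀ (U : VertexSet n) {x} → U x ≡ true → x Subset.∈ tabulate U
    ∈tabulate⁺ U {x} Ux = lookup⇒[]= x (tabulate U) (trans (lookup∘tabulate U x) Ux)

    ∈tabulate⁻ : ∀ (U : VertexSet n) {x} → x Subset.∈ tabulate U → U x ≡ true
    ∈tabulate⁻ U {x} x∈ = trans (sym (lookup∘tabulate U x)) ([]=⇒lookup x∈)

  size-∖ : ∀ {S I y} → S y ≡ true → I y ≡ true → size (S ∖ I) < size S
  size-∖ {S} {I} {y} Sy Iy = p⊂q⇒∣p∣<∣q∣ {p = tabulate (S ∖ I)} {q = tabulate S}
    ( (λ x∈ → ∈tabulate⁺ S (∖-⊆ {U = S} {V = I} _ (∈tabulate⁻ (S ∖ I) x∈)))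
    , y , ∈tabulate⁺ S Sy , λ y∈ → true≢false Iy (not-true⁻ (proj₂ (∧-true⁻ (∈tabulate⁻ (S ∖ I) y∈)))))

  rounds    : ℕ → ℕ → VertexSet n → Prog n ⊤
  nextRound : ℕ → ℕ → VertexSet n → VertexSet n → Rejections n → Prog n ⊤

  rounds zero    D S = return tt
  rounds (suc f) D S = greedy S ∅ D D 0 >>= λ (I , W) → linkRejected I D W >> nextRound f D S I W

  -- Without rejections S ⊆ I and nothing is left; another round would cost a query that
  -- no output pays for.
  nextRound f D S I []      = return tt
  nextRound f D S I (_ ∷ _) = rounds f D (S ∖ I)

module _ {n : ℕ} (I : VertexSet n) where

  Leaving : Fin n × Fin n → Set
  Leaving (w , x) = I w ≡ false × I x ≡ true

  private
    leaving-≢⇒¬same : ∀ {e f} → Leaving e → Leaving f → e ≢ f → ¬ SameEdge e f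
    leaving-≢⇒¬same _        _        e≢f (inj₁ (refl , refl)) = e≢f refl
    leaving-≢⇒¬same (_ , Ix) (If , _) _   (inj₂ (_ , refl))    = true≢false Ix If

  leaving-unique⇒distinct : ∀ {es} → All Leaving es → Unique es → AllPairs (λ e f → ¬ SameEdge e f) es
  leaving-unique⇒distinct []         []          = []
  leaving-unique⇒distinct (le ∷ les) (e∉ ∷ uniq) =
    All.zipWith (λ (lf , e≢f) → leaving-≢⇒¬same le lf e≢f) (les , e∉) ∷ leaving-unique⇒distinct les uniq

module Rounds {n : ℕ} (G : Graph n) (K D : ℕ) (n≤2ᴰ : n ≤ 2 ^ D)
               (4D+3≤K : D * 2 + suc (D * 2) + 2 ≤ K) (6D+2≤K : D * 2 + suc (D * 2) + suc (D * 2) ≤ K) where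
  open Execution (indepOracle G)
  open Credit {n} K
  open GreedyScan G K D n≤2ᴰ
  open Linking G K D n≤2ᴰ

  InducedEdge : VertexSet n → Fin n × Fin n → Set
  InducedEdge S (u , v) = S u ≡ true × S v ≡ true × adj G u v ≡ true

  record Enumerates (S : VertexSet n) (t : List (Event n)) : Set where
    field
      sound    : All (InducedEdge S) (outputs t)
      complete : ∀ {u v} → S u ≡ true → S v ≡ true → adj G u v ≡ true → Any (SameEdge (u , v)) (outputs t)
      distinct : AllPairs (λ e f → ¬ SameEdge e f) (outputs t)

  scans-∅⇒⊆ : ∀ {S d a t I W} → Scans S ∅ d a t I W → I ⊆ S
  scans-∅⇒⊆ T x Ix with Scans.within T x Ix
  ... | inj₂ (Sx , _) = Sx

  nothing-left : ∀ {S t I} → Scans S ∅ D 0 t I [] → Enumerates (S ∖ I) []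
  nothing-left T = record
    { sound    = []
    ; complete = λ {u} S∖Iu _ _ →
        ⊥-elim (¬Any[] (Scans.covered T u (proj₁ (∧-true⁻ S∖Iu)) (block-whole u n≤2ᴰ)
                                           (not-true⁻ (proj₂ (∧-true⁻ S∖Iu)))))
    ; distinct = []
    }

  round-enumerates : ∀ {S tT I W tF tN} → Scans S ∅ D 0 tT I W → Links I W tF → Enumerates (S ∖ I) tN →
                     Enumerates S (tT ++ tF ++ tN)
  round-enumerates {S} {tT} {I} {W} {tF} {tN} T F N = record
    { sound    = subst (All (InducedEdge S)) (sym outputs≡)
                   (All.++⁺ (All.tabulate sound-T) (All.++⁺ (All.tabulate sound-F) (All.map sound-N N.sound)))
    ; complete = complete
    ; distinct = subst (AllPairs (λ e f → ¬ SameEdge e f))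
                   (trans (++-assoc (outputs tT) (outputs tF) (outputs tN)) (sym outputs≡))
                   (AllPairs.++⁺ (leaving-unique⇒distinct I leaving unique-TF) N.distinct
                      (All.map (λ {e} le → All.map (λ {f} Sf → not-same le Sf) N.sound) leaving))
    }
    where
    module T = Scans T
    module F = Links F
    module N = Enumerates N

    outputs≡ : outputs (tT ++ tF ++ tN) ≡ outputs tT ++ outputs tF ++ outputs tN
    outputs≡ = trans (outputs-++ tT (tF ++ tN)) (cong (outputs tT ++_) (outputs-++ tF tN))

    I⊆S = scans-∅⇒⊆ T

    rejection : ∀ {w Jw} → (w , Jw) ∈ W → S w ≡ true × I w ≡ false × Jw ⊆ I
    rejection p∈ with Sw , _ , Iw , Jw⊆I , _ ← All.lookup T.rejected p∈ = Sw , Iw , Jw⊆I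

    sound-T : ∀ {e} → e ∈ outputs tT → InducedEdge S e
    sound-T e∈ with Jw , p∈ , Jwx , wx ← T.sound e∈ =
      proj₁ (rejection p∈) , I⊆S _ (proj₂ (proj₂ (rejection p∈)) _ Jwx) , wx

    sound-N : ∀ {e} → InducedEdge (S ∖ I) e → InducedEdge S e
    sound-N (u∈ , v∈ , uv) = ∖-⊆ {U = S} {V = I} _ u∈ , ∖-⊆ {U = S} {V = I} _ v∈ , uv

    sound-F : ∀ {e} → e ∈ outputs tF → InducedEdge S e
    sound-F e∈ with Jw , p∈ , Ix , _ , wx ← F.sound e∈ = proj₁ (rejection p∈) , I⊆S _ Ix , wx

    -- An edge from a rejected vertex v into I was output either when v was rejected or in the link pass.
    into-I : ∀ {u v} → I u ≡ true → S v ≡ true → I v ≡ false → adj G v u ≡ true →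
             (v , u) ∈ outputs (tT ++ tF ++ tN)
    into-I {u} {v} Iu Sv Iv vu rewrite outputs≡ with ∈-map⁻ proj₁ (T.covered v Sv (block-whole v n≤2ᴰ) Iv)
    ... | (_ , Jv) , p∈ , refl with Jv u in Jvu
    ...   | true  = ∈-++⁺ˡ (T.complete p∈ Jvu vu)
    ...   | false = ∈-++⁺ʳ (outputs tT) (∈-++⁺ˡ (F.complete p∈ Iu Jvu vu))

    complete : ∀ {u v} → S u ≡ true → S v ≡ true → adj G u v ≡ true → Any (SameEdge (u , v)) (outputs (tT ++ tF ++ tN))
    complete {u} {v} Su Sv uv with I u in Iu | I v in Iv
    ... | true  | true  = ⊥-elim (true≢false uv (T.independent u v Iu Iv))
    ... | true  | false = Any.map (λ { refl → inj₂ (refl , refl) }) (into-I Iu Sv Iv (trans (Graph.sym G v u) uv))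
    ... | false | true  = Any.map (λ { refl → inj₁ (refl , refl) }) (into-I Iv Su Iu uv)
    ... | false | false = subst (Any (SameEdge (u , v))) (sym outputs≡)
                            (Any.++⁺ʳ (outputs tT) (Any.++⁺ʳ (outputs tF)
                              (N.complete (∧-true⁺ Su (not-true⁺ Iu)) (∧-true⁺ Sv (not-true⁺ Iv)) uv)))

    leaving : All (Leaving I) (outputs tT ++ outputs tF)
    leaving = All.tabulate λ e∈ → leaves (∈-++⁻ (outputs tT) e∈)
      where
      leaves : ∀ {e} → e ∈ outputs tT ⊎ e ∈ outputs tF → Leaving I e
      leaves (inj₁ e∈) with Jw , p∈ , Jwx , _ ← T.sound e∈ =
        proj₁ (proj₂ (rejection p∈)) , proj₂ (proj₂ (rejection p∈)) _ Jwx
      leaves (inj₂ e∈) with Jw , p∈ , Ix , _ ← F.sound e∈ = proj₁ (proj₂ (rejection p∈)) , Ix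

    unique-TF : Unique (outputs tT ++ outputs tF)
    unique-TF = Unique.++⁺ T.unique (F.unique T.distinct) λ (e∈T , e∈F) → disjoint e∈T e∈F
      where
      disjoint : ∀ {e} → e ∈ outputs tT → e ∈ outputs tF → ⊥
      disjoint e∈T e∈F with _ , p∈ , Jx , _ ← T.sound e∈T | _ , p∈′ , _ , J′x , _ ← F.sound e∈F
        rewrite Unique-keys⇒≡ T.distinct p∈ p∈′ = true≢false Jx J′x

    not-same : ∀ {e f} → Leaving I e → InducedEdge (S ∖ I) f → ¬ SameEdge e f
    not-same (_ , Ix) (_ , S∖Iy , _) (inj₁ (_ , refl)) = true≢false Ix (not-true⁻ (proj₂ (∧-true⁻ S∖Iy)))
    not-same (_ , Ix) (S∖Iy , _ , _) (inj₂ (_ , refl)) = true≢false Ix (not-true⁻ (proj₂ (∧-true⁻ S∖Iy)))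

  δ≤K : D * 2 + suc (D * 2) ≤ K
  δ≤K = ≤-trans (m≤m+n _ 2) 4D+3≤K

  γ≤K : D * 2 ≤ K
  γ≤K = ≤-trans (m≤m+n (D * 2) _) δ≤K

  ∅-independent : Independent G ∅
  ∅-independent _ _ ()

  rounds-trace : ∀ f S → let scan = greedy S ∅ D D 0 ; I = proj₁ (result scan) ; W = proj₂ (result scan) in
                 trace (rounds (suc f) D S) ≡ trace scan ++ trace (linkRejected I D W) ++ trace (nextRound f D S I W)
  rounds-trace f S = trans (trace->>= scan _) (cong (trace scan ++_) (trace->>= link _))
    where
    scan = greedy S ∅ D D 0
    link = linkRejected (proj₁ (result scan)) D (proj₂ (result scan))

  rounds-spends : ∀ f S → Spends (D * 2 + suc (D * 2)) 1 (trace (rounds f D S))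
  round-spends : ∀ f {S tT I} W → Scans S ∅ D 0 tT I W →
                 Spends (D * 2 + suc (D * 2)) 1 (tT ++ trace (linkRejected I D W) ++ trace (nextRound f D S I W))

  rounds-spends zero    S = spends-[]
  rounds-spends (suc f) S = subst (Spends _ 1) (sym (rounds-trace f S)) (round-spends f _ (greedy-scans ∅-independent D 0))

  round-spends f {tT = tT} [] T = subst (Spends _ 1) (sym (++-identityʳ tT)) (earns⇒spends {m = 0} δ≤K (Scans.cost T δ≤K))
  round-spends f {S} {I = I} W@(_ ∷ _) T =
    spends-round {m = length W} 4D+3≤K 6D+2≤K (s≤s z≤n) (Scans.cost T δ≤K)
      (Links.cost (linkRejected-links (Scans.independent T) W) γ≤K) (rounds-spends f (S ∖ I))

  rounds-enumerates : ∀ f S → size S ≤ f → Enumerates S (trace (rounds f D S))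
  next-enumerates  : ∀ f {S tT I} W → size S ≤ suc f → Scans S ∅ D 0 tT I W →
                     Enumerates (S ∖ I) (trace (nextRound f D S I W))

  rounds-enumerates zero S size≤0 = record
    { sound    = []
    ; complete = λ Su _ _ → ⊥-elim (<⇒≱ (≤-<-trans z≤n (size-∖ {I = S} Su Su)) size≤0)
    ; distinct = []
    }
  rounds-enumerates (suc f) S size≤ =
    subst (Enumerates S) (sym (rounds-trace f S))
      (round-enumerates scan (linkRejected-links (Scans.independent scan) _) (next-enumerates f _ size≤ scan))
    where scan = greedy-scans {S} ∅-independent D 0

  next-enumerates f []             _     T = nothing-left T
  next-enumerates f {S} {I = I} ((w , Jw) ∷ W) size≤ T
    with _ , _ , _ , Jw⊆I , x , Jwx , _ ← All.lookup (Scans.rejected T) (here refl) =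
    rounds-enumerates f (S ∖ I)
      (s≤s⁻¹ (<-≤-trans (size-∖ {S = S} {I = I} (scans-∅⇒⊆ T x (Jw⊆I x Jwx)) (Jw⊆I x Jwx)) size≤))

-- Counting the listed edges

module _ {n : ℕ} where

  canonical : Fin n × Fin n → Fin n × Fin n
  canonical (u , v) = if toℕ u <ᵇ toℕ v then (u , v) else (v , u)

  SameEdge-sym : ∀ {e f : Fin n × Fin n} → SameEdge e f → SameEdge f e
  SameEdge-sym (inj₁ (refl , refl)) = inj₁ (refl , refl)
  SameEdge-sym (inj₂ (refl , refl)) = inj₂ (refl , refl)

  SameEdge-trans : ∀ {e f g : Fin n × Fin n} → SameEdge e f → SameEdge f g → SameEdge e g
  SameEdge-trans (inj₁ (refl , refl)) s                    = s
  SameEdge-trans (inj₂ (refl , refl)) (inj₁ (refl , refl)) = inj₂ (refl , refl)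
  SameEdge-trans (inj₂ (refl , refl)) (inj₂ (refl , refl)) = inj₁ (refl , refl)

  SameEdge-canonical : ∀ e → SameEdge e (canonical e)
  SameEdge-canonical (u , v) with toℕ u <ᵇ toℕ v
  ... | true  = inj₁ (refl , refl)
  ... | false = inj₂ (refl , refl)

  canonical-≡⇒SameEdge : ∀ {e f} → canonical e ≡ canonical f → SameEdge e f
  canonical-≡⇒SameEdge {e} {f} eq =
    SameEdge-trans (SameEdge-canonical e) (subst (λ g → SameEdge g f) (sym eq) (SameEdge-sym (SameEdge-canonical f)))

module _ {n : ℕ} (G : Graph n) (A : Subset n) where

  -- Must agree with the summand of numEdges.
  isEdge : Fin n × Fin n → ℕ
  isEdge (u , v) = if (toℕ u <ᵇ toℕ v) ∧ lookup A u ∧ lookup A v ∧ adj G u v then 1 else 0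

  isEdge-canonical : ∀ {u v} → lookup A u ≡ true → lookup A v ≡ true → adj G u v ≡ true →
                     isEdge (canonical (u , v)) ≡ 1
  isEdge-canonical {u} {v} Au Av uv with toℕ u <ᵇ toℕ v in u<v
  ... | true rewrite u<v | Au | Av | uv = refl
  ... | false with toℕ v <ᵇ toℕ u in v<u
  ...   | true rewrite Av | Au | Graph.sym G v u | uv = refl
  ...   | false = ⊥-elim (true≢false uv (subst (λ w → adj G u w ≡ false) u≡v (irrefl G u)))
    where
    u≡v : u ≡ v
    u≡v = toℕ-injective (≤-antisym (≮⇒≥ (λ v<u′ → true≢false (T⇒≡true (<⇒<ᵇ v<u′)) v<u))
                                   (≮⇒≥ (λ u<v′ → true≢false (T⇒≡true (<⇒<ᵇ u<v′)) u<v)))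

  distinct-edges≤numEdges : ∀ {es} → All (λ (u , v) → lookup A u ≡ true × lookup A v ≡ true × adj G u v ≡ true) es →
                            AllPairs (λ e f → ¬ SameEdge e f) es → length es ≤ numEdges G A
  distinct-edges≤numEdges {es} edges distinct = subst (_≤ numEdges G A) (length-map canonical es)
    (length≤sum isEdge (pairs n)
      (AllPairs.map⁺ (AllPairs.map (λ ¬same → ¬same ∘ canonical-≡⇒SameEdge) distinct))
      (λ {e} _ → pair∈pairs (proj₁ e) (proj₂ e))
      isEdge≡1)
    where
    isEdge≡1 : ∀ {e} → e ∈ map canonical es → isEdge e ≡ 1
    isEdge≡1 e∈ with _ , e∈es , refl ← ∈-map⁻ canonical e∈
                with Au , Av , uv ← All.lookup edges e∈es = isEdge-canonical Au Av uv

private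
  module _ (L : ℕ) where

    4L+3≤8L : 1 ≤ L → L * 2 + suc (L * 2) + 2 ≤ L * 8
    4L+3≤8L (s≤s {n = L′} _) = ≤-trans (m≤m+n _ (L′ * 4 + 1)) (≤-reflexive (expand L′))
      where
      expand : ∀ L′ → suc L′ * 2 + suc (suc L′ * 2) + 2 + (L′ * 4 + 1) ≡ suc L′ * 8
      expand = solve-∀

    6L+2≤8L : 1 ≤ L → L * 2 + suc (L * 2) + suc (L * 2) ≤ L * 8
    6L+2≤8L (s≤s {n = L′} _) = ≤-trans (m≤m+n _ (L′ * 2)) (≤-reflexive (expand L′))
      where
      expand : ∀ L′ → suc L′ * 2 + suc (suc L′ * 2) + suc (suc L′ * 2) + L′ * 2 ≡ suc L′ * 8
      expand = solve-∀

    prefix-bound : ∀ i → L * 2 + suc (L * 2) + 1 + i * (L * 8) ≤ 8 * (1 + suc i * L)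
    prefix-bound i = ≤-trans (m≤m+n _ (6 + L * 4)) (≤-reflexive (expand L i))
      where
      expand : ∀ L i → L * 2 + suc (L * 2) + 1 + i * (L * 8) + (6 + L * 4) ≡ 8 * (1 + suc i * L)
      expand = solve-∀

    total-bound : ∀ {Q c b m E} → Q + c ≡ b + m * (L * 8) → b ≤ c + 1 → m ≤ E → Q ≤ 8 * (1 + E * L)
    total-bound {Q} {c} {b} {m} {E} q+c≡ b≤c+1 m≤E =
      ≤-trans (+-cancelʳ-≤ c Q (1 + E * (L * 8)) (begin
        Q + c                  ≡⟨ q+c≡ ⟩
        b + m * (L * 8)        ≤⟨ +-mono-≤ b≤c+1 (*-monoˡ-≤ (L * 8) m≤E) ⟩
        c + 1 + E * (L * 8)    ≡⟨ regroup c E L ⟩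
        1 + E * (L * 8) + c    ∎))
      (≤-trans (m≤m+n _ 7) (≤-reflexive (expand E L)))
      where
      open ≤-Reasoning
      regroup : ∀ c E L → c + 1 + E * (L * 8) ≡ 1 + E * (L * 8) + c
      regroup = solve-∀
      expand : ∀ E L → 1 + E * (L * 8) + 7 ≡ 8 * (1 + E * L)
      expand = solve-∀

-- With n ≤ 1 there is no edge, and ⌈log₂ n⌉ = 0 would make the credit argument fail.
algorithm : (n : ℕ) → Subset n → Proc n
algorithm n@(suc (suc _)) A = toProc (rounds n ⌈log₂ n ⌉ (lookup A))
algorithm _               _ = done

Guarantee : ℕ → (n : ℕ) → Graph n → Subset n → List (Event n) → Set
Guarantee C n G A tr =
  ListsEdges G A (outputs tr)
  × (∀ (t : ℕ) → 1 ≤ t → t ≤ numEdges G A → queriesBefore tr t ≤ C * (1 + t * ⌈log₂ n ⌉))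
  × totalQueries tr ≤ C * (1 + numEdges G A * ⌈log₂ n ⌉)

module _ {m : ℕ} (G : Graph (suc (suc m))) (A : Subset (suc (suc m))) where
  private
    n = suc (suc m)
    L = ⌈log₂ n ⌉
    open Execution (indepOracle G)
    open Credit {n} (L * 8)
    open Rounds G (L * 8) L (n≤2^⌈log₂n⌉ n) (4L+3≤8L L (s≤s z≤n)) (6L+2≤8L L (s≤s z≤n))
    module E = Enumerates (rounds-enumerates n (lookup A) (∣p∣≤n (tabulate (lookup A))))

  rounds-guarantee : Guarantee 8 n G A (trace (rounds n L (lookup A)))
  rounds-guarantee =
    ( ( All.map (λ (Au , Av , uv) → lookup⇒[]= _ A Au , lookup⇒[]= _ A Av , uv) E.sound
      , (λ u v u∈A v∈A uv → E.complete ([]=⇒lookup u∈A) ([]=⇒lookup v∈A) uv)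
      , E.distinct )
    , (λ { (suc i) _ _ → ≤-trans (pays⇒queriesBefore pays i) (prefix-bound L i) })
    , total-bound L (pays⇒totalQueries pays) b≤c+1 (distinct-edges≤numEdges G A E.sound E.distinct) )
    where
    spent = rounds-spends n (lookup A) _ ≤-refl
    pays = proj₁ (proj₂ spent)
    b≤c+1 = proj₂ (proj₂ spent)

algorithm-guarantee : ∀ n (G : Graph n) A → Guarantee 8 n G A (run (algorithm n A) (indepOracle G))
algorithm-guarantee zero G A = ([] , (λ ()) , []) , (λ _ _ _ → z≤n) , z≤n
algorithm-guarantee (suc zero) G A =
  ([] , (λ { zero zero _ _ loop → ⊥-elim (true≢false loop (irrefl G zero)) }) , []) , (λ _ _ _ → z≤n) , z≤n
algorithm-guarantee n@(suc (suc _)) G A =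
  subst (Guarantee 8 n G A) (sym (Execution.run-toProc (indepOracle G) (rounds n ⌈log₂ n ⌉ (lookup A))))
    (rounds-guarantee G A)

lemma3p6 : Σ[ C ∈ ℕ ] Σ[ alg ∈ ((n : ℕ) → Subset n → Proc n) ] (∀ (n : ℕ) (G : Graph n) (A : Subset n) →
    ListsEdges G A (outputs (run (alg n A) (indepOracle G)))
    × (∀ (t : ℕ) → 1 ≤ t → t ≤ numEdges G A →
         queriesBefore (run (alg n A) (indepOracle G)) t ≤ C * (1 + t * ⌈log₂ n ⌉))
    × totalQueries (run (alg n A) (indepOracle G)) ≤ C * (1 + numEdges G A * ⌈log₂ n ⌉))
lemma3p6 = 8 , algorithm , algorithm-guarantee
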